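{- The hypersequent $C=\ \Rightarrow\neg\Box\neg\Box(p\land q)\lor\Box(\neg\Box p\lor\Box\neg\Box q)$ is valid in the class of $\mathbf{K4}$ (transitive) Kripke frames, i.e. $\vDash_{\mathbf{K4}} C$.
   Context: A Kripke model $\langle W,R,v\rangle$ has classical truth conditions, with $v(\Box\phi,x)=1$ iff $v(\phi,y)=1$ for all $y$ with $xRy$. A hypersequent $\Gamma_1\Rightarrow\Delta_1\,/\!/\,\dots\,/\!/\,\Gamma_n\Rightarrow\Delta_n$ has a countermodel if there is a branch $w_1,\dots,w_n$ (with $w_iRw_{i+1}$) such that at each $w_i$ every formula of $\Gamma_i$ is true and every formula of $\Delta_i$ is false; it is valid in a class of frames if it has no countermodel there. For a single sequent $\Rightarrow\phi$ this means $\phi$ is true at every point of every model on such a frame. -}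

module Defs where

open import Level using (Level; suc; _⊔_)
open import Data.Nat using (ℕ)
open import Data.Bool using (Bool; true; false; not; _∧_; _∨_)
open import Data.Product using (_×_)
open import Relation.Binary.PropositionalEquality using (_≡_)

infixr 30 _∧ᶠ_
infixr 20 _∨ᶠ_
data Fm : Set where
  var  : ℕ → Fm
  ¬ᶠ_  : Fm → Fm
  _∧ᶠ_ : Fm → Fm → Fm
  _∨ᶠ_ : Fm → Fm → Fm
  □_   : Fm → Fm

record Frame (a r : Level) : Set (suc (a ⊔ r)) where
  field
    W : Set a
    R : W → W → Set r

Transitive : ∀ {a r} → Frame a r → Set (a ⊔ r)
Transitive F = ∀ {x y z} → R x y → R y z → R x z
  where open Frame F

-- A Kripke model on a frame: a valuation v(φ,x) ∈ {0,1} on all formulas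
-- satisfying the classical truth conditions (the paper's formulation).
record Model {a r : Level} (F : Frame a r) : Set (a ⊔ r) where
  open Frame F
  field
    v     : Fm → W → Bool
    v-¬   : ∀ φ x → v (¬ᶠ φ) x ≡ not (v φ x)
    v-∧   : ∀ φ ψ x → v (φ ∧ᶠ ψ) x ≡ (v φ x ∧ v ψ x)
    v-∨   : ∀ φ ψ x → v (φ ∨ᶠ ψ) x ≡ (v φ x ∨ v ψ x)
    v-□⇒  : ∀ φ x → v (□ φ) x ≡ true → ∀ y → R x y → v φ y ≡ true
    v-□⇐  : ∀ φ x → (∀ y → R x y → v φ y ≡ true) → v (□ φ) x ≡ true

-- Validity of the single-sequent hypersequent  ⇒ φ  in the class of
-- transitive (K4) frames: φ is true at every point of every model
-- on every transitive frame.
K4-valid : ∀ (a r : Level) → Fm → Set (suc (a ⊔ r))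
K4-valid a r φ = (F : Frame a r) → Transitive F → (M : Model F) →
  ∀ (x : Frame.W F) → Model.v M φ x ≡ true

p q : Fm
p = var 0
q = var 1

C-formula : Fm
C-formula = (¬ᶠ □ ¬ᶠ □ (p ∧ᶠ q)) ∨ᶠ □ ((¬ᶠ □ p) ∨ᶠ □ ¬ᶠ □ q)

{-# OPTIONS --safe #-}
-- Read C as  □¬□(p ∧ q) → □(□p → □¬□q).  Given xRy with □p at y and yRz with
-- □q at z, transitivity gives □p at z as well, hence □(p ∧ q) at z; but xRz,
-- so ¬□(p ∧ q) holds at z.
module Submission where

open import Defs
open import Level using (Level)
open import Data.Bool using (true; false)
open import Data.Empty using (⊥)
open import Relation.Binary.PropositionalEquality using (_≡_; refl)

module ModelProperties {a r : Level} {F : Frame a r} (M : Model F) where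
  open Frame F
  open Model M

  v-¬-intro : ∀ φ x → (v φ x ≡ true → ⊥) → v (¬ᶠ φ) x ≡ true
  v-¬-intro φ x φ-false rewrite v-¬ φ x with v φ x
  ... | false = refl
  ... | true with φ-false refl
  ... | ()

  v-¬-elim : ∀ φ x → v (¬ᶠ φ) x ≡ true → v φ x ≡ true → ⊥
  v-¬-elim φ x ¬φ-true φ-true rewrite v-¬ φ x | φ-true with ¬φ-true
  ... | ()

  v-⇒-intro : ∀ φ ψ x → (v φ x ≡ true → v ψ x ≡ true) → v ((¬ᶠ φ) ∨ᶠ ψ) x ≡ true
  v-⇒-intro φ ψ x φ⇒ψ rewrite v-∨ (¬ᶠ φ) ψ x | v-¬ φ x with v φ x
  ... | false = refl
  ... | true rewrite φ⇒ψ refl = refl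

  v-∧-intro : ∀ φ ψ x → v φ x ≡ true → v ψ x ≡ true → v (φ ∧ᶠ ψ) x ≡ true
  v-∧-intro φ ψ x φ-true ψ-true rewrite v-∧ φ ψ x | φ-true | ψ-true = refl

  v-□-∧-intro : ∀ φ ψ x → v (□ φ) x ≡ true → v (□ ψ) x ≡ true → v (□ (φ ∧ᶠ ψ)) x ≡ true
  v-□-∧-intro φ ψ x □φ □ψ = v-□⇐ (φ ∧ᶠ ψ) x λ y xy →
    v-∧-intro φ ψ y (v-□⇒ φ x □φ y xy) (v-□⇒ ψ x □ψ y xy)

  v-□-four : Transitive F → ∀ φ {x y} → v (□ φ) x ≡ true → R x y → v (□ φ) y ≡ true
  v-□-four trans-R φ {x} {y} □φ xy = v-□⇐ φ y λ z yz → v-□⇒ φ x □φ z (trans-R xy yz)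

mainTheorem2 : ∀ (a r : Level) → K4-valid a r C-formula
mainTheorem2 a r F trans-R M x =
  v-⇒-intro (□ ¬ᶠ □ (p ∧ᶠ q)) _ x λ □¬□pq →
  v-□⇐ _ x λ y xy →
  v-⇒-intro (□ p) _ y λ □p →
  v-□⇐ _ y λ z yz →
  v-¬-intro (□ q) z λ □q →
  v-¬-elim (□ (p ∧ᶠ q)) z (v-□⇒ _ x □¬□pq z (trans-R xy yz))
    (v-□-∧-intro p q z (v-□-four trans-R p □p yz) □q)
  where
  open Model M
  open ModelProperties M
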